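{- There are no square-free $P_4$-words of length $16$.
   Context: $P_4$ is the path on vertices $\{0,1,2,3\}$ with edges $01,12,23$. A $P_4$-word is a word $i_1i_2\cdots i_k$ over $\{0,1,2,3\}$ such that each consecutive pair $i_ji_{j+1}$ is an edge of $P_4$. A word is square-free if it has no factor $uu$ with $u$ nonempty. -}

module Defs where

open import Data.Fin using (Fin; zero; suc)
open import Data.List using (List; []; _∷_; _++_; length)
open import Data.Product using (∃; _×_; _,_)
open import Data.Empty using (⊥)
open import Relation.Binary.PropositionalEquality using (_≡_; _≢_)
open import Relation.Nullary using (¬_)

V : Set
V = Fin 4

data Edge : V → V → Set where
  e01 : Edge zero (suc zero)
  e10 : Edge (suc zero) zero
  e12 : Edge (suc zero) (suc (suc zero))
  e21 : Edge (suc (suc zero)) (suc zero)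
  e23 : Edge (suc (suc zero)) (suc (suc (suc zero)))
  e32 : Edge (suc (suc (suc zero))) (suc (suc zero))

data P4Word : List V → Set where
  []ʷ  : P4Word []
  [_]ʷ : (a : V) → P4Word (a ∷ [])
  _∷ʷ_ : ∀ {a b w} → Edge a b → P4Word (b ∷ w) → P4Word (a ∷ b ∷ w)

HasSquare : List V → Set
HasSquare w = ∃ λ x → ∃ λ u → ∃ λ y → (u ≢ []) × (w ≡ x ++ (u ++ u) ++ y)

SquareFree : List V → Set
SquareFree w = ¬ HasSquare w

-- A square in w survives in a ∷ w, and the only new
-- squares of a ∷ w are its prefixes; so a depth-first search that prunes words which are
-- not P4-words or begin with a square explores exactly the square-free P4-words, and
-- evaluation shows that none of them reaches length 16.
module Submission where

open import Defs
open import Data.Fin using (zero; suc)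
open import Data.Fin.Properties using (_≟_)
open import Data.List using (List; []; _∷_; _++_; _ʳ++_; length; reverse; take; drop)
open import Data.List.Properties
  using (≡-dec; take++drop≡id; ++-assoc; reverse-involutive; length-reverse)
open import Data.Maybe using (Maybe; just; nothing; from-just)
open import Data.Nat using (ℕ; zero; suc; ⌊_/2⌋)
open import Data.Product using (_×_; _,_)
open import Function using (_∘_)
open import Relation.Binary.PropositionalEquality using (_≡_; _≢_; refl; sym; trans; cong; subst; module ≡-Reasoning)
open import Relation.Nullary using (¬_; Dec; yes; no; contradiction)
open import Relation.Nullary.Decidable using (map′; _×-dec_)

edge? : (a b : V) → Dec (Edge a b)
edge? zero                   zero                   = no λ ()
edge? zero                   (suc zero)             = yes e01
edge? zero                   (suc (suc _))          = no λ ()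
edge? (suc zero)             zero                   = yes e10
edge? (suc zero)             (suc zero)             = no λ ()
edge? (suc zero)             (suc (suc zero))       = yes e12
edge? (suc zero)             (suc (suc (suc _)))    = no λ ()
edge? (suc (suc zero))       zero                   = no λ ()
edge? (suc (suc zero))       (suc zero)             = yes e21
edge? (suc (suc zero))       (suc (suc zero))       = no λ ()
edge? (suc (suc zero))       (suc (suc (suc zero))) = yes e23
edge? (suc (suc (suc zero))) zero                   = no λ ()
edge? (suc (suc (suc zero))) (suc zero)             = no λ ()
edge? (suc (suc (suc zero))) (suc (suc zero))       = yes e32
edge? (suc (suc (suc zero))) (suc (suc (suc zero))) = no λ ()

p4Word? : (w : List V) → Dec (P4Word w)
p4Word? []          = yes []ʷ
p4Word? (a ∷ [])    = yes [ a ]ʷ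
p4Word? (a ∷ b ∷ w) = map′ (λ (e , p) → e ∷ʷ p) (λ { (e ∷ʷ p) → e , p })
                           (edge? a b ×-dec p4Word? (b ∷ w))

P4Word-tail : ∀ {a w} → P4Word (a ∷ w) → P4Word w
P4Word-tail [ a ]ʷ   = []ʷ
P4Word-tail (_ ∷ʷ p) = p

HasSquare-∷ : ∀ a {w} → HasSquare w → HasSquare (a ∷ w)
HasSquare-∷ a (x , u , y , u≢[] , w≡xuuy) = a ∷ x , u , y , u≢[] , cong (a ∷_) w≡xuuy

HasSquare-prefix : ∀ k w → take k w ≢ [] → take k w ≡ take k (drop k w) → HasSquare w
HasSquare-prefix k w u≢[] u≡u′ = [] , u , rest , u≢[] , w≡uu++rest
  where
  open ≡-Reasoning
  u    = take k w
  rest = drop k (drop k w)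
  w≡uu++rest : w ≡ (u ++ u) ++ rest
  w≡uu++rest = begin
    w                                   ≡⟨ sym (take++drop≡id k w) ⟩
    u ++ drop k w                       ≡⟨ cong (u ++_) (sym (take++drop≡id k (drop k w))) ⟩
    u ++ (take k (drop k w) ++ rest)    ≡⟨ cong (λ v → u ++ (v ++ rest)) (sym u≡u′) ⟩
    u ++ (u ++ rest)                    ≡⟨ sym (++-assoc u u rest) ⟩
    (u ++ u) ++ rest                    ∎

findPrefixSquare : ℕ → (w : List V) → Maybe (HasSquare w)
findPrefixSquare zero    _       = nothing
findPrefixSquare (suc k) []      = nothing
findPrefixSquare (suc k) (a ∷ w)
  with ≡-dec _≟_ (take (suc k) (a ∷ w)) (take (suc k) (drop (suc k) (a ∷ w)))
... | yes u≡u′ = just (HasSquare-prefix (suc k) (a ∷ w) (λ ()) u≡u′)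
... | no _     = findPrefixSquare k (a ∷ w)

SquareForced : ℕ → List V → Set
SquareForced zero    w = P4Word w → HasSquare w
SquareForced (suc n) w = ∀ a → SquareForced n (a ∷ w)

squareForced-ʳ++ : ∀ n {w} → SquareForced n w →
                   ∀ v → length v ≡ n → P4Word (v ʳ++ w) → HasSquare (v ʳ++ w)
squareForced-ʳ++ zero    forced []      refl = forced
squareForced-ʳ++ (suc n) forced (a ∷ v) refl = squareForced-ʳ++ n (forced a) v refl

squareForced-of-square : ∀ n {w} → HasSquare w → SquareForced n w
squareForced-of-square zero    sq _ = sq
squareForced-of-square (suc n) sq a = squareForced-of-square n (HasSquare-∷ a sq)

squareForced-of-¬P4Word : ∀ n {w} → ¬ P4Word w → SquareForced n w
squareForced-of-¬P4Word zero    ¬p p = contradiction p ¬p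
squareForced-of-¬P4Word (suc n) ¬p a = squareForced-of-¬P4Word n (¬p ∘ P4Word-tail)

forEachLetter : {P : V → Set} → (∀ a → Maybe (P a)) → Maybe (∀ a → P a)
forEachLetter f with f zero | f (suc zero) | f (suc (suc zero)) | f (suc (suc (suc zero)))
... | just p₀ | just p₁ | just p₂ | just p₃ = just λ where
  zero                   → p₀
  (suc zero)             → p₁
  (suc (suc zero))       → p₂
  (suc (suc (suc zero))) → p₃
... | _ | _ | _ | _ = nothing

searchSquareForced : ∀ n w → Maybe (SquareForced n w)
searchSquareForced n w with p4Word? w | findPrefixSquare ⌊ length w /2⌋ w
... | no ¬p | _       = just (squareForced-of-¬P4Word n ¬p)
... | yes _ | just sq = just (squareForced-of-square n sq)
... | yes _ | nothing with n
...   | zero  = nothing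
...   | suc m = forEachLetter λ a → searchSquareForced m (a ∷ w)

squareForced-16 : SquareForced 16 []
squareForced-16 = from-just (searchSquareForced 16 [])

lemma4 : (w : List V) → ¬ (P4Word w × SquareFree w × length w ≡ 16)
lemma4 w (p , squareFree , |w|≡16) = squareFree (subst HasSquare (reverse-involutive w) square)
  where
  square : HasSquare (reverse (reverse w))
  square = squareForced-ʳ++ 16 squareForced-16 (reverse w)
             (trans (length-reverse w) |w|≡16)
             (subst P4Word (sym (reverse-involutive w)) p)
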